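{- Let $A,B$ be arenas and $\sigma,\tau$ visible exhaustive strategies on $A\vdash B$ which are positively isomorphic. Then for every complete symmetry class $\mathsf x_A$ of $A$ and $\mathsf x_B$ of $B$, the sets $\mathrm{wit}^+_\sigma(\mathsf x_A,\mathsf x_B)$ and $\mathrm{wit}^+_\tau(\mathsf x_A,\mathsf x_B)$ have the same cardinality (in $\mathbb N\cup\{+\infty\}$).
   Context: Event structures: countable set of events, partial order $\le$ with finite down-sets, irreflexive symmetric conflict $\#$ with $e_1\#e_2\le e_2'\Rightarrow e_1\#e_2'$; configurations are finite down-closed conflict-free sets ($\mathscr C(E)$); $e\rightarrow e'$ is immediate causality. An isomorphism family $\tilde E$: bijections between configurations, containing identities, closed under composition and inverse, each with a unique restriction to any sub-configuration of its domain and some extension to any configuration containing its domain; $\theta:x\cong_Ey$; symmetry classes are classes under existence of a symmetry. A tcg $A$: such a structure with symmetry-preserved polarity $\mathrm{pol}_A$ and subfamilies $\tilde A_+,\tilde A_-$ (positive/negative symmetries, $\cong^\pm_A$) meeting only in identities, each closed within $\tilde A$ under extension by pairs of events of its own polarity. A game adds a symmetry-invariant payoff $\kappa_A:\mathscr C(A)\to\{ -1,0,+1\}$ (payoff $0$: complete) and a chosen canonical representative $\hat{\mathsf x}\in\mathsf x$ of each complete symmetry class $\mathsf x$ ($x$ canonical: each $\theta:x\cong_Ax$ factors uniquely as $\theta^+\circ\theta^-$ with $\theta^-:x\cong^-_Ax$, $\theta^+:x\cong^+_Ax$). An arena is a game with minimal events negative, $\kappa_A(\emptyset)\ge0$, $a_1\rightarrow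 a_2\Rightarrow\mathrm{pol}(a_1)\neq\mathrm{pol}(a_2)$, any two events below a common event comparable. $A\vdash B$: events $\{1\}\times|A|\uplus\{2\}\times|B|$, componentwise causality/conflict, polarities reversed on $A$, configurations $x_A\parallel x_B$, symmetries $\theta_A\parallel\theta_B$, positive symmetries those with $\theta_A\in\tilde A_-$, $\theta_B\in\tilde B_+$, negative ones with $\theta_A\in\tilde A_+$, $\theta_B\in\tilde B_-$; payoff $(-\kappa_A(x_A))\wp\kappa_B(x_B)$ ($u\wp v=+1$ if either is $+1$, else $-1$ if either is $-1$, else $0$). A strategy on a game $G$ is an event structure with symmetry $(\sigma,\tilde\sigma)$ with display $\partial_\sigma:|\sigma|\to|G|$ mapping configurations to configurations, injective on configurations, symmetries to symmetries, and: ($\sim$-receptive) for $\theta:x\cong_\sigma y$, $x\cup\{s_1\}\in\mathscr C(\sigma)$ with $s_1$ negative and $\partial\theta\cup\{(\partial s_1,a_2)\}\in\tilde G$ there is a unique $s_2$ with $\theta\cup\{(s_1,s_2)\}\in\tilde\sigma$, $\partial s_2=a_2$; (thin) for $\theta:x\cong_\sigma y$, $x\cup\{s_1\}\in\mathscr C(\sigma)$, $s_1$ positive, there is a unique $s_2$ with $y\cup\{s_2\}\in\mathscr C(\sigma)$ and $\theta\cup\{(s_1,s_2)\}\in\tilde\sigma$; minimal events negative; (courteous) $s_1\rightarrow s_2$ with $s_1$ positive or $s_2$ negative implies $\partial s_1\rightarrow\partial s_2$; (receptive) for $x\in\mathscr C(\sigma)$, negative $a\notin\partial x$ with $\partial x\cup\{a\}\in\mathscr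 C(G)$, a unique $s$ with $x\cup\{s\}\in\mathscr C(\sigma)$, $\partial s=a$. Events have the polarity of their display; a configuration is $+$-covered if its maximal events are positive. $\sigma$ is exhaustive if $\kappa_G(\partial x)\ge0$ for all $+$-covered $x$; visible if for every chain $\rho_1\rightarrow_\sigma\cdots\rightarrow_\sigma\rho_n$ with $\rho_1$ minimal, $\partial_\sigma(\{\rho_1,\dots,\rho_n\})\in\mathscr C(G)$. A positive isomorphism $\varphi:\sigma\approx\tau$ between strategies on $G$ is an isomorphism of event structures with symmetry (bijection on events preserving and reflecting causality and conflict, and inducing a bijection between the symmetries) such that for every $x\in\mathscr C(\sigma)$, $\{(\partial_\sigma s,\partial_\tau\varphi(s))\mid s\in x\}$ is a positive symmetry of $G$. For $\sigma$ on $A\vdash B$ write $\partial_\sigma(x)=x_A\parallel x_B$, and set $\mathrm{wit}^+_\sigma(\mathsf x_A,\mathsf x_B)=\{x\ +\text{ -covered in }\sigma\mid x_A\cong^-_A\hat{\mathsf x}_A,\ x_B\cong^+_B\hat{\mathsf x}_B\}$. -}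

module Defs where

open import Level using (0ℓ) renaming (suc to lsuc)
open import Data.Nat using (ℕ)
open import Data.Product using (Σ; ∃; ∃-syntax; ∃!; _×_; _,_; proj₁; proj₂)
open import Data.Sum using (_⊎_; inj₁; inj₂)
open import Data.Empty using (⊥)
open import Data.Unit using (⊤)
open import Data.List using (List; []; _∷_)
open import Data.List.Membership.Propositional using (_∈_)
open import Relation.Nullary using (¬_)
open import Relation.Binary.PropositionalEquality using (_≡_; _≢_)
open import Relation.Binary.Bundles using (Setoid)
open import Function.Definitions using (Injective)
open import Function.Bundles using (Inverse; _↔_)

Sub : Set → Set₁
Sub E = E → Set

BRel : Set → Set₁
BRel E = E → E → Set

module _ {E : Set} where

  _⊆_ : Sub E → Sub E → Set
  x ⊆ y = ∀ e → x e → y e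

  _≐_ : Sub E → Sub E → Set
  x ≐ y = (x ⊆ y) × (y ⊆ x)

  ∅ : Sub E
  ∅ _ = ⊥

  _∪｛_｝ : Sub E → E → Sub E
  (x ∪｛ e ｝) e' = x e' ⊎ e' ≡ e

  Finite : Sub E → Set
  Finite x = ∃[ l ] (∀ e → x e → e ∈ l)

  _⊆ᵣ_ : BRel E → BRel E → Set
  θ ⊆ᵣ θ' = ∀ e e' → θ e e' → θ' e e'

  _≐ᵣ_ : BRel E → BRel E → Set
  θ ≐ᵣ θ' = (θ ⊆ᵣ θ') × (θ' ⊆ᵣ θ)

  dom : BRel E → Sub E
  dom θ e = ∃[ e' ] θ e e'

  cod : BRel E → Sub E
  cod θ e' = ∃[ e ] θ e e'

  idOn : Sub E → BRel E
  idOn x e e' = x e × e ≡ e'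

  -- diagrammatic composition: (θ ⨾ θ') = θ' ∘ θ
  _⨾_ : BRel E → BRel E → BRel E
  (θ ⨾ θ') e e'' = ∃[ e' ] (θ e e' × θ' e' e'')

  inv : BRel E → BRel E
  inv θ e e' = θ e' e

  _∪ᵣ｛_,_｝ : BRel E → E → E → BRel E
  (θ ∪ᵣ｛ e₁ , e₂ ｝) e e' = θ e e' ⊎ (e ≡ e₁ × e' ≡ e₂)

  IsBijRel : BRel E → Set
  IsBijRel θ = (∀ {e e₁ e₂} → θ e e₁ → θ e e₂ → e₁ ≡ e₂)
             × (∀ {e₁ e₂ e} → θ e₁ e → θ e₂ e → e₁ ≡ e₂)

  module Order (_≤_ : BRel E) (_#_ : BRel E) where

    IsConfig : Sub E → Set
    IsConfig x = Finite x
               × (∀ e e' → e' ≤ e → x e → x e')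
               × (∀ e e' → x e → x e' → ¬ (e # e'))

    _⇝_ : BRel E
    e ⇝ e' = (e ≤ e') × (e ≢ e')
           × (∀ e'' → e ≤ e'' → e'' ≤ e' → (e'' ≡ e) ⊎ (e'' ≡ e'))

    Minimal : E → Set
    Minimal e = ∀ e' → e' ≤ e → e' ≡ e

    record IsIsoFamily (S : BRel E → Set) : Set₁ where
      field
        resp        : ∀ {θ θ'} → θ ≐ᵣ θ' → S θ → S θ'
        bij         : ∀ {θ} → S θ → IsConfig (dom θ) × IsConfig (cod θ) × IsBijRel θ
        identities  : ∀ {x} → IsConfig x → S (idOn x)
        composition : ∀ {θ θ'} → S θ → S θ' → cod θ ≐ dom θ' → S (θ ⨾ θ')
        inverse     : ∀ {θ} → S θ → S (inv θ)
        restriction : ∀ {θ x} → S θ → IsConfig x → x ⊆ dom θ →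
                      ∃! _≐ᵣ_ (λ θ' → S θ' × θ' ⊆ᵣ θ × dom θ' ≐ x)
        extension   : ∀ {θ x} → S θ → IsConfig x → dom θ ⊆ x →
                      ∃[ θ' ] (S θ' × θ ⊆ᵣ θ' × dom θ' ≐ x)

    SymIso : (BRel E → Set) → BRel E → Sub E → Sub E → Set
    SymIso S θ x y = S θ × dom θ ≐ x × cod θ ≐ y

    _≅⟨_⟩_ : Sub E → (BRel E → Set) → Sub E → Set₁
    x ≅⟨ S ⟩ y = ∃[ θ ] SymIso S θ x y

record EventStructure : Set₁ where
  field
    Ev        : Set
    countable : ∃[ f ] Injective {A = Ev} {B = ℕ} _≡_ _≡_ f
    _≤_       : BRel Ev
    _#_       : BRel Ev
    ≤-refl    : ∀ e → e ≤ e
    ≤-trans   : ∀ {e₁ e₂ e₃} → e₁ ≤ e₂ → e₂ ≤ e₃ → e₁ ≤ e₃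
    ≤-antisym : ∀ {e₁ e₂} → e₁ ≤ e₂ → e₂ ≤ e₁ → e₁ ≡ e₂
    down-finite : ∀ e → Finite (λ e' → e' ≤ e)
    #-irrefl  : ∀ e → ¬ (e # e)
    #-sym     : ∀ {e₁ e₂} → e₁ # e₂ → e₂ # e₁
    #-her     : ∀ {e₁ e₂ e₂'} → e₁ # e₂ → e₂ ≤ e₂' → e₁ # e₂'
  open Order _≤_ _#_ public

record ESS : Set₁ where
  field
    es    : EventStructure
  open EventStructure es public
  field
    Sym   : BRel Ev → Set
    isSym : IsIsoFamily Sym

data Pol : Set where
  pos neg : Pol

data Payoff : Set where
  minus zero plus : Payoff

NonNeg : Payoff → Set
NonNeg minus = ⊥
NonNeg zero  = ⊤
NonNeg plus  = ⊤

negate : Payoff → Payoff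
negate minus = plus
negate zero  = zero
negate plus  = minus

_℘_ : Payoff → Payoff → Payoff
plus  ℘ _     = plus
minus ℘ plus  = plus
minus ℘ _     = minus
zero  ℘ v     = v

record Tcg : Set₁ where
  field
    ess : ESS
  open ESS ess public
  field
    pol      : Ev → Pol
    pol-sym  : ∀ {θ e e'} → Sym θ → θ e e' → pol e ≡ pol e'
    SymP     : BRel Ev → Set
    SymN     : BRel Ev → Set
    isSymP   : IsIsoFamily SymP
    isSymN   : IsIsoFamily SymN
    SymP⊆Sym : ∀ {θ} → SymP θ → Sym θ
    SymN⊆Sym : ∀ {θ} → SymN θ → Sym θ
    P∩N-id   : ∀ {θ} → SymP θ → SymN θ → θ ≐ᵣ idOn (dom θ)
    P-ext    : ∀ {θ θ'} → SymP θ → Sym θ' → θ ⊆ᵣ θ' →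
               (∀ e e' → θ' e e' → ¬ θ e e' → pol e ≡ pos) → SymP θ'
    N-ext    : ∀ {θ θ'} → SymN θ → Sym θ' → θ ⊆ᵣ θ' →
               (∀ e e' → θ' e e' → ¬ θ e e' → pol e ≡ neg) → SymN θ'

record Game : Set₁ where
  field
    tcg : Tcg
  open Tcg tcg public
  field
    κ       : Sub Ev → Payoff
    κ-sym   : ∀ {θ x y} → SymIso Sym θ x y → κ x ≡ κ y
    -- chosen canonical representative of the complete symmetry class of x
    canon   : Sub Ev → Sub Ev
    canon-conf  : ∀ {x} → IsConfig x → κ x ≡ zero → IsConfig (canon x)
    canon-in    : ∀ {x} → IsConfig x → κ x ≡ zero → x ≅⟨ Sym ⟩ canon x
    canon-class : ∀ {x y} → IsConfig x → κ x ≡ zero → IsConfig y →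
                  x ≅⟨ Sym ⟩ y → canon x ≐ canon y
    canon-canonical : ∀ {x} → IsConfig x → κ x ≡ zero → ∀ θ →
                  SymIso Sym θ (canon x) (canon x) →
                  ∃! (λ p q → (proj₁ p ≐ᵣ proj₁ q) × (proj₂ p ≐ᵣ proj₂ q))
                     (λ p → SymIso SymN (proj₁ p) (canon x) (canon x)
                          × SymIso SymP (proj₂ p) (canon x) (canon x)
                          × θ ≐ᵣ (proj₁ p ⨾ proj₂ p))

record IsArena (A : Game) : Set where
  open Game A
  field
    min-neg    : ∀ a → Minimal a → pol a ≡ neg
    empty-nn   : NonNeg (κ ∅)
    alternate  : ∀ {a₁ a₂} → a₁ ⇝ a₂ → pol a₁ ≢ pol a₂
    forestial  : ∀ {a₁ a₂ a} → a₁ ≤ a → a₂ ≤ a → (a₁ ≤ a₂) ⊎ (a₂ ≤ a₁)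

record RawGame : Set₁ where
  field
    Ev   : Set
    _≤_  : BRel Ev
    _#_  : BRel Ev
    Sym  : BRel Ev → Set
    SymP : BRel Ev → Set
    SymN : BRel Ev → Set
    pol  : Ev → Pol
    κ    : Sub Ev → Payoff
  open Order _≤_ _#_ public

module _ {EA EB : Set} where
  restrA : BRel (EA ⊎ EB) → BRel EA
  restrA θ a a' = θ (inj₁ a) (inj₁ a')
  restrB : BRel (EA ⊎ EB) → BRel EB
  restrB θ b b' = θ (inj₂ b) (inj₂ b')
  NoCross : BRel (EA ⊎ EB) → Set
  NoCross θ = (∀ a b → ¬ θ (inj₁ a) (inj₂ b)) × (∀ a b → ¬ θ (inj₂ b) (inj₁ a))
  sumRel : BRel EA → BRel EB → BRel (EA ⊎ EB)
  sumRel r s (inj₁ a) (inj₁ a') = r a a'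
  sumRel r s (inj₂ b) (inj₂ b') = s b b'
  sumRel r s _ _ = ⊥
  projA : Sub (EA ⊎ EB) → Sub EA
  projA x a = x (inj₁ a)
  projB : Sub (EA ⊎ EB) → Sub EB
  projB x b = x (inj₂ b)

flipPol : Pol → Pol
flipPol pos = neg
flipPol neg = pos

_⊢_ : Game → Game → RawGame
A ⊢ B = record
  { Ev   = A.Ev ⊎ B.Ev
  ; _≤_  = sumRel A._≤_ B._≤_
  ; _#_  = sumRel A._#_ B._#_
  ; Sym  = λ θ → NoCross θ × A.Sym (restrA θ) × B.Sym (restrB θ)
  ; SymP = λ θ → NoCross θ × A.SymN (restrA θ) × B.SymP (restrB θ)
  ; SymN = λ θ → NoCross θ × A.SymP (restrA θ) × B.SymN (restrB θ)
  ; pol  = λ { (inj₁ a) → flipPol (A.pol a) ; (inj₂ b) → B.pol b }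
  ; κ    = λ x → negate (A.κ (projA x)) ℘ B.κ (projB x)
  }
  where module A = Game A
        module B = Game B

module _ {E F : Set} (f : E → F) where
  img : Sub E → Sub F
  img x a = ∃[ s ] (x s × f s ≡ a)
  imgᵣ : BRel E → BRel F
  imgᵣ θ a a' = ∃[ s ] ∃[ s' ] (θ s s' × f s ≡ a × f s' ≡ a')

record Strategy (G : RawGame) : Set₁ where
  module G = RawGame G
  field
    ess : ESS
  open ESS ess public
  field
    ∂        : Ev → G.Ev
    ∂-conf   : ∀ {x} → IsConfig x → G.IsConfig (img ∂ x)
    ∂-inj    : ∀ {x} → IsConfig x → ∀ {s s'} → x s → x s' → ∂ s ≡ ∂ s' → s ≡ s'
    ∂-sym    : ∀ {θ} → Sym θ → G.Sym (imgᵣ ∂ θ)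
    ~-receptive : ∀ {θ x y s₁ a₂} → SymIso Sym θ x y → IsConfig (x ∪｛ s₁ ｝) →
                  G.pol (∂ s₁) ≡ neg → G.Sym (imgᵣ ∂ θ ∪ᵣ｛ ∂ s₁ , a₂ ｝) →
                  ∃! _≡_ (λ s₂ → Sym (θ ∪ᵣ｛ s₁ , s₂ ｝) × ∂ s₂ ≡ a₂)
    thin     : ∀ {θ x y s₁} → SymIso Sym θ x y → IsConfig (x ∪｛ s₁ ｝) →
               G.pol (∂ s₁) ≡ pos →
               ∃! _≡_ (λ s₂ → IsConfig (y ∪｛ s₂ ｝) × Sym (θ ∪ᵣ｛ s₁ , s₂ ｝))
    min-neg  : ∀ s → Minimal s → G.pol (∂ s) ≡ neg
    courteous : ∀ {s₁ s₂} → s₁ ⇝ s₂ → (G.pol (∂ s₁) ≡ pos) ⊎ (G.pol (∂ s₂) ≡ neg) →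
                (∂ s₁) G.⇝ (∂ s₂)
    receptive : ∀ {x a} → IsConfig x → G.pol a ≡ neg → ¬ img ∂ x a →
                G.IsConfig (img ∂ x ∪｛ a ｝) →
                ∃! _≡_ (λ s → IsConfig (x ∪｛ s ｝) × ∂ s ≡ a)

  polσ : Ev → Pol
  polσ s = G.pol (∂ s)

  PlusCovered : Sub Ev → Set
  PlusCovered x = IsConfig x × (∀ s → x s → (∀ s' → x s' → s ≤ s' → s' ≡ s) → polσ s ≡ pos)

-- chains ρ₁ ⇝ ρ₂ ⇝ ... ⇝ ρₙ, given as ρ₁ and the list [ρ₂,...,ρₙ]
module _ {G : RawGame} (σ : Strategy G) where
  open Strategy σ

  Chain : Ev → List Ev → Set
  Chain ρ []         = ⊤
  Chain ρ (ρ' ∷ rest) = (ρ ⇝ ρ') × Chain ρ' rest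

  Exhaustive : Set₁
  Exhaustive = ∀ x → PlusCovered x → NonNeg (G.κ (img ∂ x))

  Visible : Set
  Visible = ∀ ρ₁ rest → Minimal ρ₁ → Chain ρ₁ rest →
            G.IsConfig (img ∂ (λ s → s ∈ (ρ₁ ∷ rest)))

record PosIso {G : RawGame} (σ τ : Strategy G) : Set₁ where
  private
    module σ = Strategy σ
    module τ = Strategy τ
    module G = RawGame G
  field
    φ       : σ.Ev ↔ τ.Ev
  φ→ : σ.Ev → τ.Ev
  φ→ = Inverse.to φ
  field
    ≤-pres  : ∀ {s s'} → s σ.≤ s' → φ→ s τ.≤ φ→ s'
    ≤-refl  : ∀ {s s'} → φ→ s τ.≤ φ→ s' → s σ.≤ s'
    #-pres  : ∀ {s s'} → s σ.# s' → φ→ s τ.# φ→ s'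
    #-refl  : ∀ {s s'} → φ→ s τ.# φ→ s' → s σ.# s'
    sym-pres : ∀ {θ} → σ.Sym θ → τ.Sym (imgᵣ φ→ θ)
    sym-refl : ∀ {θ} → τ.Sym (imgᵣ φ→ θ) → σ.Sym θ
    positive : ∀ {x} → σ.IsConfig x →
               G.SymP (λ a b → ∃[ s ] (x s × σ.∂ s ≡ a × τ.∂ (φ→ s) ≡ b))

-- wit⁺_σ(𝗑_A, 𝗑_B), as a setoid of configurations up to extensional equality.
-- The complete classes 𝗑_A, 𝗑_B are given by representatives xA, xB.

module _ (A B : Game) where
  private
    module A = Game A
    module B = Game B

  WitCarrier : Strategy (A ⊢ B) → Sub A.Ev → Sub B.Ev → Set₁
  WitCarrier σ xA xB =
    Σ (Sub σ.Ev) (λ x → σ.PlusCovered x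
        × (projA (img σ.∂ x) A.≅⟨ A.SymN ⟩ A.canon xA)
        × (projB (img σ.∂ x) B.≅⟨ B.SymP ⟩ B.canon xB))
    where module σ = Strategy σ

  wit⁺ : Strategy (A ⊢ B) → Sub A.Ev → Sub B.Ev → Setoid (lsuc 0ℓ) 0ℓ
  wit⁺ σ xA xB = record
    { Carrier = WitCarrier σ xA xB
    ; _≈_ = λ p q → proj₁ p ≐ proj₁ q
    ; isEquivalence = record
      { refl  = (λ _ h → h) , (λ _ h → h)
      ; sym   = λ { (f , g) → g , f }
      ; trans = λ { (f , g) (f' , g') → (λ e h → f' e (f e h)) , (λ e h → g e (g' e h)) }
      }
    }

-- equal cardinality (in ℕ ∪ {∞}) of two sets: a bijection between them
SameCard : ∀ {c ℓ c' ℓ'} → Setoid c ℓ → Setoid c' ℓ' → Set _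
SameCard S T = Inverse S T

-- A positive isomorphism φ : σ ≈ τ is a bijection on events preserving causality and
-- conflict, so x ↦ φ x is a bijection between the +-covered configurations of σ and τ.
-- The displays of x and φ x are related by a positive symmetry of A ⊢ B, that is a
-- negative symmetry on A and a positive one on B; composing it with the symmetries
-- witnessing x_A ≅⁻ x̂_A and x_B ≅⁺ x̂_B keeps their polarities, so φ restricts to a
-- bijection wit⁺_σ(𝗑_A, 𝗑_B) ≅ wit⁺_τ(𝗑_A, 𝗑_B).
module Submission where

open import Defs
open import Relation.Binary.PropositionalEquality using (_≡_; refl; sym; trans; cong; subst; subst₂; module ≡-Reasoning)
open import Data.Product using (∃-syntax; _×_; _,_; proj₁; proj₂; swap)
open import Data.Sum using (_⊎_; inj₁; inj₂)
open import Data.Empty using (⊥-elim)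
open import Data.List using (map)
open import Data.List.Membership.Propositional using (_∈_)
open import Data.List.Membership.Propositional.Properties using (∈-map⁺)
open import Function using (_∘_)
open import Function.Bundles using (Inverse; _↔_)
open import Function.Properties.Inverse using (↔-sym)

module _ {E : Set} where

  ≐-sym : {x y : Sub E} → x ≐ y → y ≐ x
  ≐-sym = swap

  ≐-trans : {x y z : Sub E} → x ≐ y → y ≐ z → x ≐ z
  ≐-trans (x⊆y , y⊆x) (y⊆z , z⊆y) = (λ e → y⊆z e ∘ x⊆y e) , (λ e → y⊆x e ∘ z⊆y e)

  ≐ᵣ-sym : {θ θ' : BRel E} → θ ≐ᵣ θ' → θ' ≐ᵣ θ
  ≐ᵣ-sym = swap

preimage-≐ : {E F : Set} (g : F → E) {x y : Sub E} → x ≐ y → (x ∘ g) ≐ (y ∘ g)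
preimage-≐ g (x⊆y , y⊆x) = (λ t → x⊆y (g t)) , (λ t → y⊆x (g t))

module _ {E F : Set} (φ : E ↔ F) where
  open Inverse φ using (to; from; strictlyInverseˡ)

  preimage-inverse : (x : Sub F) → (x ∘ to ∘ from) ≐ x
  preimage-inverse x = (λ t → subst x (strictlyInverseˡ t)) , (λ t → subst x (sym (strictlyInverseˡ t)))

  imgᵣ-inverse : (θ : BRel F) → θ ≐ᵣ imgᵣ to (imgᵣ from θ)
  imgᵣ-inverse θ =
    (λ b b' θbb' → from b , from b' , (b , b' , θbb' , refl , refl) ,
                   strictlyInverseˡ b , strictlyInverseˡ b') ,
    (λ { _ _ (_ , _ , (b , b' , θbb' , refl , refl) , refl , refl) →
           subst₂ θ (sym (strictlyInverseˡ b)) (sym (strictlyInverseˡ b')) θbb' })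

module _ {E : Set} {_≤_ _#_ : BRel E} {S : BRel E → Set}
         (fam : Order.IsIsoFamily _≤_ _#_ S) where
  open Order _≤_ _#_
  open IsIsoFamily fam

  ≅-sym : ∀ {x y} → x ≅⟨ S ⟩ y → y ≅⟨ S ⟩ x
  ≅-sym (θ , Sθ , dθ , cθ) = inv θ , inverse Sθ , cθ , dθ

  ≅-trans : ∀ {x y z} → x ≅⟨ S ⟩ y → y ≅⟨ S ⟩ z → x ≅⟨ S ⟩ z
  ≅-trans (θ , Sθ , dθ , cθ) (θ' , Sθ' , dθ' , cθ') =
    θ ⨾ θ' , composition Sθ Sθ' (≐-trans cθ (≐-sym dθ')) ,
    ≐-trans dom-⨾ dθ , ≐-trans cod-⨾ cθ'
    where
      dom-⨾ : dom (θ ⨾ θ') ≐ dom θ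
      dom-⨾ = (λ { e (_ , e' , θee' , _) → e' , θee' }) ,
              (λ { e (e' , θee') → let (e'' , θ'e'e'') = proj₂ dθ' e' (proj₁ cθ e' (e , θee'))
                                   in e'' , e' , θee' , θ'e'e'' })
      cod-⨾ : cod (θ ⨾ θ') ≐ cod θ'
      cod-⨾ = (λ { e'' (_ , e' , _ , θ'e'e'') → e' , θ'e'e'' }) ,
              (λ { e'' (e' , θ'e'e'') → let (e , θee') = proj₂ cθ e' (proj₁ dθ' e' (e'' , θ'e'e''))
                                        in e , e' , θee' , θ'e'e'' })

MaximalIn : {E : Set} → BRel E → Sub E → E → Set
MaximalIn _≤_ x s = ∀ s' → x s' → s ≤ s' → s' ≡ s

module _ {E F : EventStructure} (φ : EventStructure.Ev E ↔ EventStructure.Ev F) where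
  private
    module E = EventStructure E
    module F = EventStructure F
  open Inverse φ using (to; from; strictlyInverseˡ; strictlyInverseʳ)

  preimage-IsConfig : (∀ {t t'} → t F.≤ t' → from t E.≤ from t') →
                      (∀ {t t'} → t F.# t' → from t E.# from t') →
                      ∀ {x} → E.IsConfig x → F.IsConfig (x ∘ from)
  preimage-IsConfig from-≤ from-# ((l , x⊆l) , down , conflict-free) =
    (map to l , λ t xt → subst (_∈ map to l) (strictlyInverseˡ t) (∈-map⁺ to (x⊆l (from t) xt))) ,
    (λ t t' t'≤t → down (from t) (from t') (from-≤ t'≤t)) ,
    (λ t t' xt xt' t#t' → conflict-free (from t) (from t') xt xt' (from-# t#t'))

  preimage-maximal : (∀ {s s'} → s E.≤ s' → to s F.≤ to s') →
                     ∀ {x t} → MaximalIn F._≤_ (x ∘ from) t → MaximalIn E._≤_ x (from t)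
  preimage-maximal to-≤ {x} {t} max s xs from-t≤s =
    begin s ≡⟨ sym (strictlyInverseʳ s) ⟩ from (to s) ≡⟨ cong from to-s≡t ⟩ from t ∎
    where
      open ≡-Reasoning
      to-s≡t : to s ≡ t
      to-s≡t = max (to s) (subst x (sym (strictlyInverseʳ s)) xs)
                   (subst (F._≤ to s) (strictlyInverseˡ t) (to-≤ from-t≤s))

module _ {EA EB : Set} where

  projA-≐ : {x y : Sub (EA ⊎ EB)} → x ≐ y → projA x ≐ projA y
  projA-≐ = preimage-≐ inj₁

  projB-≐ : {x y : Sub (EA ⊎ EB)} → x ≐ y → projB x ≐ projB y
  projB-≐ = preimage-≐ inj₂

  module _ {θ : BRel (EA ⊎ EB)} (nc : NoCross θ) where

    dom-restrA : dom (restrA θ) ≐ projA (dom θ)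
    dom-restrA = (λ { a (a' , r) → inj₁ a' , r }) ,
                 (λ { a (inj₁ a' , r) → a' , r ; a (inj₂ b , r) → ⊥-elim (proj₁ nc a b r) })

    dom-restrB : dom (restrB θ) ≐ projB (dom θ)
    dom-restrB = (λ { b (b' , r) → inj₂ b' , r }) ,
                 (λ { b (inj₂ b' , r) → b' , r ; b (inj₁ a , r) → ⊥-elim (proj₂ nc a b r) })

  cod-restrA : {θ : BRel (EA ⊎ EB)} → NoCross θ → cod (restrA θ) ≐ projA (cod θ)
  cod-restrA {θ} nc = dom-restrA {θ = inv θ} (swap nc)

  cod-restrB : {θ : BRel (EA ⊎ EB)} → NoCross θ → cod (restrB θ) ≐ projB (cod θ)
  cod-restrB {θ} nc = dom-restrB {θ = inv θ} (swap nc)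

displayRel : {G : RawGame} (σ τ : Strategy G) → (Strategy.Ev σ → Strategy.Ev τ) →
             Sub (Strategy.Ev σ) → BRel (RawGame.Ev G)
displayRel σ τ f x a b = ∃[ s ] (x s × Strategy.∂ σ s ≡ a × Strategy.∂ τ (f s) ≡ b)

module _ (A B : Game) where
  private
    module A = Game A
    module B = Game B
    module G = RawGame (A ⊢ B)

  ⊢-SymP-inv : ∀ {θ} → G.SymP θ → G.SymP (inv θ)
  ⊢-SymP-inv (nc , SAθ , SBθ) =
    swap nc , A.IsIsoFamily.inverse A.isSymN SAθ , B.IsIsoFamily.inverse B.isSymP SBθ

  ⊢-SymP-resp : ∀ {θ θ'} → θ ≐ᵣ θ' → G.SymP θ → G.SymP θ'
  ⊢-SymP-resp (θ⊆θ' , θ'⊆θ) (nc , SAθ , SBθ) =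
    ((λ a b → proj₁ nc a b ∘ θ'⊆θ _ _) , (λ a b → proj₂ nc a b ∘ θ'⊆θ _ _)) ,
    A.IsIsoFamily.resp A.isSymN ((λ _ _ → θ⊆θ' _ _) , (λ _ _ → θ'⊆θ _ _)) SAθ ,
    B.IsIsoFamily.resp B.isSymP ((λ _ _ → θ⊆θ' _ _) , (λ _ _ → θ'⊆θ _ _)) SBθ

  ⊢-SymP-pol : ∀ {θ e e'} → G.SymP θ → θ e e' → G.pol e ≡ G.pol e'
  ⊢-SymP-pol {e = inj₁ a} {inj₁ a'} (_ , SAθ , _) r = cong flipPol (A.pol-sym (A.SymN⊆Sym SAθ) r)
  ⊢-SymP-pol {e = inj₂ b} {inj₂ b'} (_ , _ , SBθ) r = B.pol-sym (B.SymP⊆Sym SBθ) r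
  ⊢-SymP-pol {e = inj₁ a} {inj₂ b} (nc , _) r = ⊥-elim (proj₁ nc a b r)
  ⊢-SymP-pol {e = inj₂ b} {inj₁ a} (nc , _) r = ⊥-elim (proj₂ nc a b r)

  ⊢-SymP-projA : ∀ {θ x y} → G.SymIso G.SymP θ x y → projA x A.≅⟨ A.SymN ⟩ projA y
  ⊢-SymP-projA {θ} ((nc , SAθ , _) , dθ , cθ) =
    restrA θ , SAθ , ≐-trans (dom-restrA {θ = θ} nc) (projA-≐ dθ) ,
                     ≐-trans (cod-restrA {θ = θ} nc) (projA-≐ cθ)

  ⊢-SymP-projB : ∀ {θ x y} → G.SymIso G.SymP θ x y → projB x B.≅⟨ B.SymP ⟩ projB y
  ⊢-SymP-projB {θ} ((nc , _ , SBθ) , dθ , cθ) =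
    restrB θ , SBθ , ≐-trans (dom-restrB {θ = θ} nc) (projB-≐ dθ) ,
                     ≐-trans (cod-restrB {θ = θ} nc) (projB-≐ cθ)

  module _ {σ τ : Strategy (A ⊢ B)} (P : PosIso σ τ) where
    private
      module σ = Strategy σ
      module τ = Strategy τ
    open PosIso P
    open Inverse φ using (to; from; strictlyInverseˡ; strictlyInverseʳ)

    PosIso-sym : PosIso τ σ
    PosIso-sym = record
      { φ        = ↔-sym φ
      ; ≤-pres   = λ t≤t' → ≤-refl (subst₂ τ._≤_ (sym (strictlyInverseˡ _)) (sym (strictlyInverseˡ _)) t≤t')
      ; ≤-refl   = λ s≤s' → subst₂ τ._≤_ (strictlyInverseˡ _) (strictlyInverseˡ _) (≤-pres s≤s')
      ; #-pres   = λ t#t' → #-refl (subst₂ τ._#_ (sym (strictlyInverseˡ _)) (sym (strictlyInverseˡ _)) t#t')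
      ; #-refl   = λ s#s' → subst₂ τ._#_ (strictlyInverseˡ _) (strictlyInverseˡ _) (#-pres s#s')
      ; sym-pres = λ {θ} Sθ → sym-refl (τ.IsIsoFamily.resp τ.isSym (imgᵣ-inverse φ θ) Sθ)
      ; sym-refl = λ {θ} Sθ → τ.IsIsoFamily.resp τ.isSym (≐ᵣ-sym (imgᵣ-inverse φ θ)) (sym-pres Sθ)
      ; positive = λ {y} y-conf →
          ⊢-SymP-resp (inv-display y)
            (⊢-SymP-inv {θ = displayRel σ τ to (y ∘ to)}
              (positive (preimage-IsConfig {τ.es} {σ.es} (↔-sym φ) ≤-pres #-pres y-conf)))
      }
      where
        inv-display : ∀ y → inv (displayRel σ τ to (y ∘ to)) ≐ᵣ displayRel τ σ from y
        inv-display y =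
          (λ { _ _ (s , y-to-s , ∂s , ∂-to-s) →
                 to s , y-to-s , ∂-to-s , trans (cong σ.∂ (strictlyInverseʳ s)) ∂s }) ,
          (λ { _ _ (t , yt , ∂t , ∂-from-t) →
                 from t , subst y (sym (strictlyInverseˡ t)) yt , ∂-from-t ,
                 trans (cong τ.∂ (strictlyInverseˡ t)) ∂t })

    display-iso : ∀ {x} → σ.IsConfig x →
                  G.SymIso G.SymP (displayRel σ τ to x) (img σ.∂ x) (img τ.∂ (x ∘ from))
    display-iso {x} x-conf =
      positive x-conf ,
      ((λ { _ (_ , s , xs , ∂s , _) → s , xs , ∂s }) ,
       (λ { _ (s , xs , ∂s) → τ.∂ (to s) , s , xs , ∂s , refl })) ,
      ((λ { _ (_ , s , xs , _ , ∂-to-s) → to s , subst x (sym (strictlyInverseʳ s)) xs , ∂-to-s }) ,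
       (λ { _ (t , x-from-t , ∂t) → σ.∂ (from t) , from t , x-from-t , refl ,
                                      trans (cong τ.∂ (strictlyInverseˡ t)) ∂t }))

    transport-PlusCovered : ∀ {x} → σ.PlusCovered x → τ.PlusCovered (x ∘ from)
    transport-PlusCovered {x} (x-conf , x-max-pos) =
      preimage-IsConfig {σ.es} {τ.es} φ (PosIso.≤-pres PosIso-sym) (PosIso.#-pres PosIso-sym) x-conf ,
      λ t x-from-t t-max →
        subst (λ u → τ.polσ u ≡ pos) (strictlyInverseˡ t)
          (trans (sym (⊢-SymP-pol {θ = displayRel σ τ to x} (positive x-conf)
                                  (from t , x-from-t , refl , refl)))
                 (x-max-pos (from t) x-from-t (preimage-maximal {σ.es} {τ.es} φ ≤-pres t-max)))

    transport-wit⁺ : ∀ {xA xB} → WitCarrier A B σ xA xB → WitCarrier A B τ xA xB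
    transport-wit⁺ (x , x-pc , x≅xA , x≅xB) =
      x ∘ from , transport-PlusCovered x-pc ,
      ≅-trans A.isSymN (≅-sym A.isSymN (⊢-SymP-projA (display-iso (proj₁ x-pc)))) x≅xA ,
      ≅-trans B.isSymP (≅-sym B.isSymP (⊢-SymP-projB (display-iso (proj₁ x-pc)))) x≅xB

  wit⁺-Inverse : ∀ {σ τ} → PosIso σ τ → ∀ xA xB → SameCard (wit⁺ A B σ xA xB) (wit⁺ A B τ xA xB)
  wit⁺-Inverse P xA xB = record
    { to        = transport-wit⁺ P
    ; from      = transport-wit⁺ (PosIso-sym P)
    ; to-cong   = preimage-≐ from
    ; from-cong = preimage-≐ to
    ; inverse   = (λ {w} v≐w∘to → ≐-trans (preimage-≐ from v≐w∘to) (preimage-inverse φ (proj₁ w))) ,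
                  (λ {v} w≐v∘from → ≐-trans (preimage-≐ to w≐v∘from) (preimage-inverse (↔-sym φ) (proj₁ v)))
    }
    where open PosIso P using (φ)
          open Inverse φ using (to; from)

proposition5p5 : (A B : Game) → IsArena A → IsArena B →
    (σ τ : Strategy (A ⊢ B)) →
    Visible σ → Exhaustive σ → Visible τ → Exhaustive τ →
    PosIso σ τ →
    (xA : Sub (Game.Ev A)) → Game.IsConfig A xA → Game.κ A xA ≡ zero →
    (xB : Sub (Game.Ev B)) → Game.IsConfig B xB → Game.κ B xB ≡ zero →
    SameCard (wit⁺ A B σ xA xB) (wit⁺ A B τ xA xB)
proposition5p5 A B _ _ σ τ _ _ _ _ P xA _ _ xB _ _ = wit⁺-Inverse A B P xA xB
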